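{- Let $T=U(T_{i,0},T_{i,1},T_{i,2}: 0\le i\le m-1)$ be the union described in the context, and let $R^T$ be a region of $T$ such that $sig_{R^T}(k_{18i+2+3\ell})=-1$ for all $i\in\{0,\dots,m-1\}$ and $\ell\in\{0,\dots,5\}$. Then $R^T=\bigcup_{i=0}^{m-1}R^{T_i}$ where, for each $i$, $R^{T_i}$ is one of $R^{T_i}_c=\{t_{i,0,0},t_{i,0,4},t_{i,1,0},t_{i,1,3},t_{i,2,0},t_{i,2,3}\}$, $R^{T_i}_b=R^{T_i}_c\cup\{t_{i,0,3},t_{i,1,2},t_{i,2,2}\}$, $R^{T_i}_a=R^{T_i}_c\cup\{t_{i,0,2},t_{i,0,3}\}$. Consequently, for every clause $K_i=\{X_a,X_b,X_c\}$ there is exactly one variable event $X\in K_i$ with $sig_{R^T}(X)=1$.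
   Context: Let $\varphi=\{K_0,\dots,K_{m-1}\}$ be a set of $m$ clauses over boolean variables $X_0,\dots,X_{m-1}$, each clause consisting of exactly three distinct variables, each variable occurring in exactly three clauses; for each $i$ fix a listing $K_i=\{X_a,X_b,X_c\}$ of its variables ($a,b,c$ depending on $i$). For each $i$ define linear transition systems (paths with distinct states): $T_{i,0}= t_{i,0,0}\xrightarrow{k_{18i+2}}t_{i,0,1}\xrightarrow{X_a}t_{i,0,2}\xrightarrow{\tilde X^{(i)}_b}t_{i,0,3}\xrightarrow{X_c}t_{i,0,4}\xrightarrow{k_{18i+11}}t_{i,0,5}$, $T_{i,1}= t_{i,1,0}\xrightarrow{k_{18i+5}}t_{i,1,1}\xrightarrow{X_b}t_{i,1,2}\xrightarrow{p_i}t_{i,1,3}\xrightarrow{k_{18i+14}}t_{i,1,4}$, $T_{i,2}= t_{i,2,0}\xrightarrow{k_{18i+8}}t_{i,2,1}\xrightarrow{\tilde X^{(i)}_b}t_{i,2,2}\xrightarrow{p_i}t_{i,2,3}\xrightarrow{k_{18i+17}}t_{i,2,4}$. Variable events $X_j$ are shared among all translators in which variable $X_j$ occurs; $\tilde X^{(i)}_b$, $p_i$ and the key copies $k_n$ are distinct events. All state sets are pairwise disjoint. A region of the union $T$ is a set $R$ of its states with a signature $sig_R$ from the events to $\{ -1,0,1\}$ such that $R(s')=R(s)+sig_R(e)$ for every edge $s\xrightarrow{e}s'$ of every component, where $R(s)=1$ if $s\in R$ and $0$ otherwise. -}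

module Defs where

open import Data.Nat using (ℕ; _+_; _*_)
open import Data.Fin using (Fin; toℕ; _≟_)
open import Data.Fin.Patterns using (0F; 1F; 2F; 3F; 4F; 5F)
open import Data.Integer using (ℤ; +_; -[1+_])
open import Data.Bool using (Bool; true; false)
open import Data.List using (List; []; _∷_; _++_; length; filter; allFin)
open import Data.List.Membership.Propositional using (_∈_)
open import Data.Product using (_×_; _,_; Σ; ∃; ∃-syntax)
open import Data.Sum using (_⊎_)
open import Relation.Nullary using (¬_)
open import Relation.Nullary.Decidable using (_⊎-dec_)
open import Relation.Binary.PropositionalEquality using (_≡_)

-- A 3-regular set of m 3-clauses over m variables X_0..X_{m-1}:
-- clause K_i is listed as {X_(a i), X_(b i), X_(c i)}.
record Clauses (m : ℕ) : Set where
  field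
    a b c : Fin m → Fin m
    a≢b : ∀ i → ¬ (a i ≡ b i)
    a≢c : ∀ i → ¬ (a i ≡ c i)
    b≢c : ∀ i → ¬ (b i ≡ c i)
  Occ : Fin m → Fin m → Set
  Occ j i = (a i ≡ j) ⊎ ((b i ≡ j) ⊎ (c i ≡ j))
  field
    occ3 : ∀ j → length (filter (λ i → (a i ≟ j) ⊎-dec ((b i ≟ j) ⊎-dec (c i ≟ j))) (allFin m)) ≡ 3

data Event (m : ℕ) : Set where
  var    : Fin m → Event m   -- X_j (shared among translators)
  tildeX : Fin m → Event m   -- X~^(i)_b
  p      : Fin m → Event m
  key    : ℕ → Event m

-- States: s0 i k = t_{i,0,k}, s1 i k = t_{i,1,k}, s2 i k = t_{i,2,k}.
data State (m : ℕ) : Set where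
  s0 : Fin m → Fin 6 → State m
  s1 : Fin m → Fin 5 → State m
  s2 : Fin m → Fin 5 → State m

Edge : ℕ → Set
Edge m = State m × Event m × State m

edges : ∀ {m} → Clauses m → Fin m → List (Edge m)
edges φ i =
    (s0 i 0F , key (18 * toℕ i + 2)  , s0 i 1F)
  ∷ (s0 i 1F , var (a i)             , s0 i 2F)
  ∷ (s0 i 2F , tildeX i              , s0 i 3F)
  ∷ (s0 i 3F , var (c i)             , s0 i 4F)
  ∷ (s0 i 4F , key (18 * toℕ i + 11) , s0 i 5F)
  ∷ (s1 i 0F , key (18 * toℕ i + 5)  , s1 i 1F)
  ∷ (s1 i 1F , var (b i)             , s1 i 2F)
  ∷ (s1 i 2F , p i                   , s1 i 3F)
  ∷ (s1 i 3F , key (18 * toℕ i + 14) , s1 i 4F)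
  ∷ (s2 i 0F , key (18 * toℕ i + 8)  , s2 i 1F)
  ∷ (s2 i 1F , tildeX i              , s2 i 2F)
  ∷ (s2 i 2F , p i                   , s2 i 3F)
  ∷ (s2 i 3F , key (18 * toℕ i + 17) , s2 i 4F)
  ∷ []
  where open Clauses φ

⟦_⟧ : Bool → ℤ
⟦ true ⟧ = + 1
⟦ false ⟧ = + 0

data SigVal : ℤ → Set where
  minus : SigVal -[1+ 0 ]
  nought : SigVal (+ 0)
  plus  : SigVal (+ 1)

record Region {m : ℕ} (φ : Clauses m) : Set where
  field
    R     : State m → Bool
    sig   : Event m → ℤ
    sigOK : ∀ e → SigVal (sig e)
    cond  : ∀ i {s e s'} → (s , e , s') ∈ edges φ i →
            ⟦ R s' ⟧ ≡ ⟦ R s ⟧ Data.Integer.+ sig e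

data Shape : Set where
  shA shB shC : Shape

RTc : ∀ {m} → Fin m → List (State m)
RTc i = s0 i 0F ∷ s0 i 4F ∷ s1 i 0F ∷ s1 i 3F ∷ s2 i 0F ∷ s2 i 3F ∷ []

RT : ∀ {m} → Fin m → Shape → List (State m)
RT i shC = RTc i
RT i shB = RTc i ++ (s0 i 3F ∷ s1 i 2F ∷ s2 i 2F ∷ [])
RT i shA = RTc i ++ (s0 i 2F ∷ s0 i 3F ∷ [])

ExactlyOne : Set → Set → Set → Set
ExactlyOne P Q S = (P × ¬ Q × ¬ S) ⊎ ((¬ P × Q × ¬ S) ⊎ (¬ P × ¬ Q × S))

module Submission where

-- Fix a translator i.  The six key events k_{18i+2+3ℓ} all have
-- signature -1, so each key edge leaves R: its source lies in R and its target
-- does not.  This fixes R at both ends of the inner segments of T_{i,0}, T_{i,1},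
-- T_{i,2}.  Along any edge the signature is the difference of the R-values of
-- its endpoints, so the two occurrences of X~^(i)_b, and the two of p_i, must
-- give the same difference; solving these two equations over the four unknown
-- inner values leaves exactly three solutions, the shapes A, B, C.

open import Defs
open import Data.Nat using (ℕ; _+_; _*_)
open import Data.Fin using (Fin; toℕ; #_)
open import Data.Fin.Patterns using (0F; 1F; 2F; 3F; 4F; 5F)
open import Data.Integer using (ℤ; +_; -[1+_]; _-_)
import Data.Integer as ℤ
open import Data.Integer.Properties using (+-0-abelianGroup)
open import Algebra.Properties.AbelianGroup +-0-abelianGroup using (xyx⁻¹≈y)
open import Data.Nat.Properties using (+-assoc)
open import Data.Bool using (Bool; true; false)
open import Data.List using (lookup)
open import Data.List.Relation.Unary.All as All using (All; []; _∷_)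
open import Data.List.Relation.Unary.Any using (here; there)
open import Data.List.Membership.Propositional using (_∈_)
open import Data.List.Membership.Propositional.Properties using (∈-lookup; ∈-++⁺ˡ; ∈-++⁺ʳ)
open import Data.Product using (_×_; Σ; ∃-syntax; _,_; proj₁; proj₂)
open import Data.Sum using (inj₁; inj₂)
open import Function using (id)
open import Function.Bundles using (_⇔_; mk⇔)
open import Relation.Binary.PropositionalEquality using (_≡_; refl; sym; trans)

in0 : Fin 6 → Shape → Bool
in0 0F _   = true
in0 1F _   = false
in0 2F shA = true
in0 2F _   = false
in0 3F shC = false
in0 3F _   = true
in0 4F _   = true
in0 5F _   = false

in12 : Fin 5 → Shape → Bool
in12 0F _   = true
in12 1F _   = false
in12 2F shB = true
in12 2F _   = false
in12 3F _   = true
in12 4F _   = false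

owner : ∀ {m} → State m → Fin m
owner (s0 i _) = i
owner (s1 i _) = i
owner (s2 i _) = i

inShape : ∀ {m} → State m → Shape → Bool
inShape (s0 _ k) = in0 k
inShape (s1 _ k) = in12 k
inShape (s2 _ k) = in12 k

RT-sound : ∀ {m} (i : Fin m) sh → All (λ s → owner s ≡ i × inShape s sh ≡ true) (RT i sh)
RT-sound i shA = (refl , refl) ∷ (refl , refl) ∷ (refl , refl) ∷ (refl , refl)
               ∷ (refl , refl) ∷ (refl , refl) ∷ (refl , refl) ∷ (refl , refl) ∷ []
RT-sound i shB = (refl , refl) ∷ (refl , refl) ∷ (refl , refl) ∷ (refl , refl) ∷ (refl , refl)
               ∷ (refl , refl) ∷ (refl , refl) ∷ (refl , refl) ∷ (refl , refl) ∷ []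
RT-sound i shC = (refl , refl) ∷ (refl , refl) ∷ (refl , refl)
               ∷ (refl , refl) ∷ (refl , refl) ∷ (refl , refl) ∷ []

RTc⊆RT : ∀ {m} {i : Fin m} {s} sh → s ∈ RTc i → s ∈ RT i sh
RTc⊆RT shA = ∈-++⁺ˡ
RTc⊆RT shB = ∈-++⁺ˡ
RTc⊆RT shC = id

RT-complete : ∀ {m} (s : State m) sh → inShape s sh ≡ true → s ∈ RT (owner s) sh
RT-complete (s0 i 0F) sh  _    = RTc⊆RT sh (here refl)
RT-complete (s0 i 2F) shA refl = ∈-++⁺ʳ (RTc i) (here refl)
RT-complete (s0 i 3F) shA refl = ∈-++⁺ʳ (RTc i) (there (here refl))
RT-complete (s0 i 3F) shB refl = ∈-++⁺ʳ (RTc i) (here refl)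
RT-complete (s0 i 4F) sh  _    = RTc⊆RT sh (there (here refl))
RT-complete (s1 i 0F) sh  _    = RTc⊆RT sh (there (there (here refl)))
RT-complete (s1 i 2F) shB refl = ∈-++⁺ʳ (RTc i) (there (here refl))
RT-complete (s1 i 3F) sh  _    = RTc⊆RT sh (there (there (there (here refl))))
RT-complete (s2 i 0F) sh  _    = RTc⊆RT sh (there (there (there (there (here refl)))))
RT-complete (s2 i 2F) shB refl = ∈-++⁺ʳ (RTc i) (there (there (here refl)))
RT-complete (s2 i 3F) sh  _    = RTc⊆RT sh (there (there (there (there (there (here refl))))))
RT-complete (s0 i 1F) _   ()
RT-complete (s0 i 2F) shB ()
RT-complete (s0 i 2F) shC ()
RT-complete (s0 i 3F) shC ()
RT-complete (s0 i 5F) _   ()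
RT-complete (s1 i 1F) _   ()
RT-complete (s1 i 2F) shA ()
RT-complete (s1 i 2F) shC ()
RT-complete (s1 i 4F) _   ()
RT-complete (s2 i 1F) _   ()
RT-complete (s2 i 2F) shA ()
RT-complete (s2 i 2F) shC ()
RT-complete (s2 i 4F) _   ()

unionOfShapes : ∀ {m} (R : State m → Bool) (f : Fin m → Shape) →
                (∀ s → R s ≡ inShape s (f (owner s))) →
                ∀ s → (R s ≡ true) ⇔ (∃[ i ] (s ∈ RT i (f i)))
unionOfShapes R f agree s = mk⇔ into (λ (i , s∈) → outOf (All.lookup (RT-sound i (f i)) s∈))
  where
  into : R s ≡ true → ∃[ i ] (s ∈ RT i (f i))
  into Rs = owner s , RT-complete s (f (owner s)) (trans (sym (agree s)) Rs)

  outOf : ∀ {i} → owner s ≡ i × inShape s (f i) ≡ true → R s ≡ true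
  outOf (refl , marked) = trans (agree s) marked

differenceOf : ∀ {x y d : ℤ} → y ≡ x ℤ.+ d → d ≡ y - x
differenceOf {x} {d = d} refl = sym (xyx⁻¹≈y x d)

sigAlong : ∀ {x y bx by : Bool} {d : ℤ} → x ≡ bx → y ≡ by → ⟦ y ⟧ ≡ ⟦ x ⟧ ℤ.+ d → d ≡ ⟦ by ⟧ - ⟦ bx ⟧
sigAlong refl refl = differenceOf

keyEdge : ∀ {x y : Bool} {d : ℤ} → d ≡ -[1+ 0 ] → ⟦ y ⟧ ≡ ⟦ x ⟧ ℤ.+ d → x ≡ true × y ≡ false
keyEdge {true}  {false} refl refl = refl , refl
keyEdge {true}  {true}  refl ()
keyEdge {false} {true}  refl ()
keyEdge {false} {false} refl ()

-- The two p_i edges of T_{i,1} and T_{i,2} both end in R, so they start equally.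
pConsistent : ∀ (r s : Bool) → + 1 - ⟦ r ⟧ ≡ + 1 - ⟦ s ⟧ → r ≡ s
pConsistent true  true  _ = refl
pConsistent false false _ = refl
pConsistent true  false ()
pConsistent false true  ()

-- The local classification: given the value r02 after X_a, r03 after X~ on
-- T_{i,0}, and r22 after X~ on T_{i,2}, consistency of X~ leaves three shapes.
classify : ∀ (r02 r03 r22 : Bool) → ⟦ r03 ⟧ - ⟦ r02 ⟧ ≡ ⟦ r22 ⟧ - + 0 →
           Σ Shape λ sh → r02 ≡ in0 2F sh × r03 ≡ in0 3F sh × r22 ≡ in12 2F sh
classify false false false _ = shC , refl , refl , refl
classify false true  true  _ = shB , refl , refl , refl
classify true  true  false _ = shA , refl , refl , refl
classify false false true  ()
classify false true  false ()
classify true  false false ()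
classify true  false true  ()
classify true  true  true  ()

exactlyOneEnters : ∀ sh → ExactlyOne (⟦ in0 2F sh ⟧ - ⟦ in0 1F sh ⟧ ≡ + 1)
                                      (⟦ in12 2F sh ⟧ - ⟦ in12 1F sh ⟧ ≡ + 1)
                                      (⟦ in0 4F sh ⟧ - ⟦ in0 3F sh ⟧ ≡ + 1)
exactlyOneEnters shA = inj₁ (refl , (λ ()) , (λ ()))
exactlyOneEnters shB = inj₂ (inj₁ ((λ ()) , refl , (λ ())))
exactlyOneEnters shC = inj₂ (inj₂ ((λ ()) , (λ ()) , refl))

exactlyOne-cong : ∀ {A : Set} {x x′ y y′ z z′ w : A} → x ≡ x′ → y ≡ y′ → z ≡ z′ →
                  ExactlyOne (x′ ≡ w) (y′ ≡ w) (z′ ≡ w) → ExactlyOne (x ≡ w) (y ≡ w) (z ≡ w)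
exactlyOne-cong refl refl refl = id

module Analysis {m : ℕ} (φ : Clauses m) (ρ : Region φ)
  (keys : ∀ (i : Fin m) (ℓ : Fin 6) → Region.sig ρ (key (18 * toℕ i + 2 + 3 * toℕ ℓ)) ≡ -[1+ 0 ]) where
  open Region ρ
  open Clauses φ using (a; b; c)

  Law : Edge m → Set
  Law (s , e , s′) = ⟦ R s′ ⟧ ≡ ⟦ R s ⟧ ℤ.+ sig e

  law : ∀ i (k : Fin 13) → Law (lookup (edges φ i) k)
  law i k = cond i (∈-lookup k)

  -- The hypothesis with the key index in the shape appearing in the edges.
  keySig : ∀ i ℓ → sig (key (18 * toℕ i + (2 + 3 * toℕ ℓ))) ≡ -[1+ 0 ]
  keySig i ℓ rewrite sym (+-assoc (18 * toℕ i) 2 (3 * toℕ ℓ)) = keys i ℓ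

  module Translator (i : Fin m) where
    key0 : R (s0 i 0F) ≡ true × R (s0 i 1F) ≡ false
    key0 = keyEdge (keySig i 0F) (law i (# 0))
    key3 : R (s0 i 4F) ≡ true × R (s0 i 5F) ≡ false
    key3 = keyEdge (keySig i 3F) (law i (# 4))
    key1 : R (s1 i 0F) ≡ true × R (s1 i 1F) ≡ false
    key1 = keyEdge (keySig i 1F) (law i (# 5))
    key4 : R (s1 i 3F) ≡ true × R (s1 i 4F) ≡ false
    key4 = keyEdge (keySig i 4F) (law i (# 8))
    key2 : R (s2 i 0F) ≡ true × R (s2 i 1F) ≡ false
    key2 = keyEdge (keySig i 2F) (law i (# 9))
    key5 : R (s2 i 3F) ≡ true × R (s2 i 4F) ≡ false
    key5 = keyEdge (keySig i 5F) (law i (# 12))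

    tildeConsistent : ⟦ R (s0 i 3F) ⟧ - ⟦ R (s0 i 2F) ⟧ ≡ ⟦ R (s2 i 2F) ⟧ - + 0
    tildeConsistent = trans (sym (sigAlong refl refl (law i (# 2))))
                            (sigAlong (proj₂ key2) refl (law i (# 10)))

    pOn1 : sig (p i) ≡ + 1 - ⟦ R (s1 i 2F) ⟧
    pOn1 = sigAlong (refl {x = R (s1 i 2F)}) (proj₁ key4) (law i (# 7))
    pOn2 : sig (p i) ≡ + 1 - ⟦ R (s2 i 2F) ⟧
    pOn2 = sigAlong (refl {x = R (s2 i 2F)}) (proj₁ key5) (law i (# 11))

    sameBeforeP : R (s1 i 2F) ≡ R (s2 i 2F)
    sameBeforeP = pConsistent (R (s1 i 2F)) (R (s2 i 2F)) (trans (sym pOn1) pOn2)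

    local : Σ Shape λ sh → R (s0 i 2F) ≡ in0 2F sh × R (s0 i 3F) ≡ in0 3F sh × R (s2 i 2F) ≡ in12 2F sh
    local = classify (R (s0 i 2F)) (R (s0 i 3F)) (R (s2 i 2F)) tildeConsistent

    shape : Shape
    shape = proj₁ local

    value0 : ∀ k → R (s0 i k) ≡ in0 k shape
    value0 0F = proj₁ key0
    value0 1F = proj₂ key0
    value0 2F = proj₁ (proj₂ local)
    value0 3F = proj₁ (proj₂ (proj₂ local))
    value0 4F = proj₁ key3
    value0 5F = proj₂ key3

    value2 : ∀ k → R (s2 i k) ≡ in12 k shape
    value2 0F = proj₁ key2
    value2 1F = proj₂ key2
    value2 2F = proj₂ (proj₂ (proj₂ local))
    value2 3F = proj₁ key5
    value2 4F = proj₂ key5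

    value1 : ∀ k → R (s1 i k) ≡ in12 k shape
    value1 0F = proj₁ key1
    value1 1F = proj₂ key1
    value1 2F = trans sameBeforeP (value2 2F)
    value1 3F = proj₁ key4
    value1 4F = proj₂ key4

    exactlyOne : ExactlyOne (sig (var (a i)) ≡ + 1) (sig (var (b i)) ≡ + 1) (sig (var (c i)) ≡ + 1)
    exactlyOne = exactlyOne-cong (sigAlong (value0 1F) (value0 2F) (law i (# 1)))
                                 (sigAlong (value1 1F) (value1 2F) (law i (# 6)))
                                 (sigAlong (value0 3F) (value0 4F) (law i (# 3)))
                                 (exactlyOneEnters shape)

  open Translator using (shape; exactlyOne) public

  value : ∀ s → R s ≡ inShape s (shape (owner s))
  value (s0 i k) = Translator.value0 i k
  value (s1 i k) = Translator.value1 i k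
  value (s2 i k) = Translator.value2 i k

lemma3 : (m : ℕ) (φ : Clauses m) (ρ : Region φ) →
         (∀ (i : Fin m) (ℓ : Fin 6) → Region.sig ρ (key (18 * toℕ i + 2 + 3 * toℕ ℓ)) ≡ -[1+ 0 ]) →
         Σ (Fin m → Shape) (λ f → ∀ s → (Region.R ρ s ≡ true) ⇔ (∃[ i ] (s ∈ RT i (f i))))
         × (∀ i → ExactlyOne (Region.sig ρ (var (Clauses.a φ i)) ≡ + 1)
                             (Region.sig ρ (var (Clauses.b φ i)) ≡ + 1)
                             (Region.sig ρ (var (Clauses.c φ i)) ≡ + 1))
lemma3 m φ ρ keys = (shape , unionOfShapes (Region.R ρ) shape value) , exactlyOne
  where open Analysis φ ρ keys
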